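{- Let $T$ be a tournament with $V(T)=\{u_1,u_2,v_1,v_2,\ldots,v_n\}$, and suppose $T_s=T[\{v_1,\ldots,v_n\}]$ is a basic tournament. Suppose there exist $i,j\in\{1,\ldots,n\}$ with $i\ne j$ such that $u_1$ and $v_i$ are covertices in $T[V(T_s)\cup\{u_1\}]$, $u_2$ and $v_j$ are covertices in $T[V(T_s)\cup\{u_2\}]$, and $\theta_T(u_1,u_2)\cdot\theta_T(v_i,v_j)=-1$. Then $T$ is a basic tournament.
   Context: A tournament is a digraph with exactly one arc between each pair of distinct vertices; $T[X]$ denotes the subtournament induced by $X$. For distinct vertices write $\theta_T(u,v)=1$ if $u\to v$ and $-1$ otherwise. Two vertices $w_1,w_2$ of a tournament $R$ with $|V(R)|\ge3$ are covertices if $\theta_R(w_1,v)=\theta_R(w_2,v)$ for all $v\in V(R)\setminus\{w_1,w_2\}$, revertices if $\theta_R(w_1,v)=-\theta_R(w_2,v)$ for all such $v$, and CR-associated if covertices or revertices. A tournament of order at least 4 is basic if no two of its vertices are CR-associated. -}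

module Defs where

open import Data.Nat using (ℕ; suc; _≥_)
open import Data.Fin using (Fin; zero; suc)
open import Data.Integer using (ℤ; +_; -_)
open import Data.Sum using (_⊎_)
open import Data.Product using (_×_)
open import Relation.Nullary using (¬_)
open import Relation.Binary.PropositionalEquality using (_≡_; _≢_)
open import Function.Definitions using (Injective)

record Tournament (m : ℕ) : Set₁ where
  field
    _⇒_      : Fin m → Fin m → Set
    irrefl   : ∀ x → ¬ (x ⇒ x)
    total    : ∀ x y → x ≢ y → (x ⇒ y) ⊎ (y ⇒ x)
    asym     : ∀ x y → x ⇒ y → ¬ (y ⇒ x)
    dec      : ∀ x y → (x ⇒ y) ⊎ ¬ (x ⇒ y)
open Tournament public

θ : ∀ {m} → Tournament m → Fin m → Fin m → ℤ
θ T u v with dec T u v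
... | Data.Sum.inj₁ _ = + 1
... | Data.Sum.inj₂ _ = - (+ 1)

-- Induced subtournament T[X] where X is the image of an injective map f : Fin k → Fin m
-- (vertex x of T[X] corresponds to vertex f x of T).
induced : ∀ {m k} → Tournament m → (f : Fin k → Fin m) → Injective _≡_ _≡_ f → Tournament k
induced T f inj = record
  { _⇒_    = λ x y → _⇒_ T (f x) (f y)
  ; irrefl = λ x → irrefl T (f x)
  ; total  = λ x y x≢y → total T (f x) (f y) (λ e → x≢y (inj e))
  ; asym   = λ x y → asym T (f x) (f y)
  ; dec    = λ x y → dec T (f x) (f y)
  }

Covertices : ∀ {m} → Tournament m → Fin m → Fin m → Set
Covertices {m} R w₁ w₂ =
  m ≥ 3 × w₁ ≢ w₂ × (∀ v → v ≢ w₁ → v ≢ w₂ → θ R w₁ v ≡ θ R w₂ v)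

Revertices : ∀ {m} → Tournament m → Fin m → Fin m → Set
Revertices {m} R w₁ w₂ =
  m ≥ 3 × w₁ ≢ w₂ × (∀ v → v ≢ w₁ → v ≢ w₂ → θ R w₁ v ≡ - θ R w₂ v)

CRAssociated : ∀ {m} → Tournament m → Fin m → Fin m → Set
CRAssociated R w₁ w₂ = Covertices R w₁ w₂ ⊎ Revertices R w₁ w₂

Basic : ∀ {m} → Tournament m → Set
Basic {m} R = m ≥ 4 × (∀ w₁ w₂ → w₁ ≢ w₂ → ¬ CRAssociated R w₁ w₂)

-- Vertex naming for T on Fin (2 + n): u₁ = 0, u₂ = 1, v_k = k + 2 (k : Fin n).
u₁ : ∀ {n} → Fin (suc (suc n))
u₁ = zero

u₂ : ∀ {n} → Fin (suc (suc n))
u₂ = suc zero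

v : ∀ {n} → Fin n → Fin (suc (suc n))
v k = suc (suc k)

v-inj : ∀ {n} → Injective _≡_ _≡_ (v {n})
v-inj Relation.Binary.PropositionalEquality.refl = Relation.Binary.PropositionalEquality.refl

-- embedding of V(T_s) ∪ {u} into V(T): index zero ↦ u, suc k ↦ v_k
withU : ∀ {n} → Fin (suc (suc n)) → Fin (suc n) → Fin (suc (suc n))
withU u zero    = u
withU u (suc k) = v k

open Relation.Binary.PropositionalEquality using (refl)

withU₁-inj : ∀ {n} → Injective _≡_ _≡_ (withU {n} u₁)
withU₁-inj {x = zero}  {zero}  _ = refl
withU₁-inj {x = zero}  {suc y} ()
withU₁-inj {x = suc x} {zero}  ()
withU₁-inj {x = suc x} {suc y} refl = refl

withU₂-inj : ∀ {n} → Injective _≡_ _≡_ (withU {n} u₂)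
withU₂-inj {x = zero}  {zero}  _ = refl
withU₂-inj {x = zero}  {suc y} ()
withU₂-inj {x = suc x} {zero}  ()
withU₂-inj {x = suc x} {suc y} refl = refl

{-# OPTIONS --safe #-}
-- Every vertex w of T is a covertex, over V(T_s), of some v_{ρ(w)} (ρ(u₁) = i, ρ(u₂) = j,
-- ρ(v_a) = a), so a CR-association of w₁ and w₂ in T restricts to one of v_{ρ(w₁)} and
-- v_{ρ(w₂)} in T_s.  As T_s is basic this forces ρ(w₁) = ρ(w₂) and a covertex association,
-- i.e. {w₁, w₂} is {u₁, v_i} or {u₂, v_j}.  Comparing the arcs of u₁ and v_i towards u₂
-- (resp. of u₂ and v_j towards u₁) then gives θ(u₁,u₂) = θ(v_i,v_j), which the sign
-- condition excludes.
module Submission where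

open import Defs
open import Data.Nat using (ℕ; suc; _≤_; s≤s)
open import Data.Nat.Properties using (<⇒≤; m≤n⇒m≤1+n)
open import Data.Fin using (Fin; zero; suc; _≟_; punchIn)
open import Data.Fin.Properties using (0≢1+n; suc-injective; punchInᵢ≢i)
open import Data.Integer using (ℤ; _*_; -_; +_)
open import Data.Integer.Properties using (neg-involutive)
open import Data.Sign.Base using (Sign)
open import Data.Sum using (inj₁; inj₂)
open import Data.Product using (∃; _×_; _,_; proj₁; proj₂)
open import Function using (_∘_)
open import Function.Definitions using (Injective)
open import Data.Empty using (⊥-elim)
open import Relation.Nullary using (¬_; yes; no)
open import Relation.Binary.PropositionalEquality
  using (_≡_; _≢_; refl; sym; trans; cong; ≢-sym; module ≡-Reasoning)

_⊙_ : Sign → ℤ → ℤ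
Sign.+ ⊙ x = x
Sign.- ⊙ x = - x

-- Covertices (s = +) or revertices (s = −), without the side conditions w₁ ≢ w₂ and m ≥ 3.
Associated : ∀ {m} → Tournament m → Sign → Fin m → Fin m → Set
Associated R s w₁ w₂ = ∀ x → x ≢ w₁ → x ≢ w₂ → θ R w₁ x ≡ s ⊙ θ R w₂ x

-- u is a covertex of f a in T[im f ∪ {u}]; u may itself be f a.
CovertexOver : ∀ {m k} → Tournament m → (Fin k → Fin m) → Fin m → Fin k → Set
CovertexOver T f u a = ∀ c → c ≢ a → f c ≢ u × θ T u (f c) ≡ θ T (f a) (f c)

module _ {m} (R : Tournament m) where

  θ-antisym : ∀ {a b} → a ≢ b → θ R a b ≡ - θ R b a
  θ-antisym {a} {b} a≢b with dec R a b | dec R b a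
  ... | inj₁ a⇒b | inj₁ b⇒a = ⊥-elim (asym R a b a⇒b b⇒a)
  ... | inj₁ _   | inj₂ _   = refl
  ... | inj₂ _   | inj₁ _   = refl
  ... | inj₂ a⇏b | inj₂ b⇏a with total R a b a≢b
  ...   | inj₁ a⇒b = ⊥-elim (a⇏b a⇒b)
  ...   | inj₂ b⇒a = ⊥-elim (b⇏a b⇒a)

  θ-flip : ∀ {a b c d} → a ≢ b → c ≢ d → θ R a b ≡ θ R c d → θ R b a ≡ θ R d c
  θ-flip {a} {b} {c} {d} a≢b c≢d eq = begin
    θ R b a      ≡⟨ θ-antisym (≢-sym a≢b) ⟩
    - θ R a b    ≡⟨ cong -_ eq ⟩
    - θ R c d    ≡⟨ sym (θ-antisym (≢-sym c≢d)) ⟩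
    θ R d c      ∎
    where open ≡-Reasoning

  θ≢-θ : ∀ a b → θ R a b ≢ - θ R a b
  θ≢-θ a b with dec R a b
  ... | inj₁ _ = λ ()
  ... | inj₂ _ = λ ()

  θ*θ≡-1⇒θ≢θ : ∀ a b c d → θ R a b * θ R c d ≡ - (+ 1) → θ R a b ≢ θ R c d
  θ*θ≡-1⇒θ≢θ a b c d with dec R a b | dec R c d
  ... | inj₁ _ | inj₁ _ = λ ()
  ... | inj₁ _ | inj₂ _ = λ _ ()
  ... | inj₂ _ | inj₁ _ = λ _ ()
  ... | inj₂ _ | inj₂ _ = λ ()

  Associated-sym : ∀ s {w₁ w₂} → Associated R s w₁ w₂ → Associated R s w₂ w₁
  Associated-sym Sign.+ r x x≢w₂ x≢w₁ = sym (r x x≢w₁ x≢w₂)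
  Associated-sym Sign.- r x x≢w₂ x≢w₁ =
    trans (sym (neg-involutive _)) (cong -_ (sym (r x x≢w₁ x≢w₂)))

  CRAssociated⇒Associated : ∀ {w₁ w₂} → CRAssociated R w₁ w₂ → ∃ λ s → Associated R s w₁ w₂
  CRAssociated⇒Associated (inj₁ (_ , _ , r)) = Sign.+ , r
  CRAssociated⇒Associated (inj₂ (_ , _ , r)) = Sign.- , r

  Associated⇒CRAssociated : ∀ s {w₁ w₂} → 3 ≤ m → w₁ ≢ w₂ →
                            Associated R s w₁ w₂ → CRAssociated R w₁ w₂
  Associated⇒CRAssociated Sign.+ 3≤m w₁≢w₂ r = inj₁ (3≤m , w₁≢w₂ , r)
  Associated⇒CRAssociated Sign.- 3≤m w₁≢w₂ r = inj₂ (3≤m , w₁≢w₂ , r)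

  self-associated⇒+ : ∀ s {a} → 2 ≤ m → Associated R s a a → s ≡ Sign.+
  self-associated⇒+ Sign.+ _ _ = refl
  self-associated⇒+ Sign.- {a} (s≤s (s≤s _)) r =
    ⊥-elim (θ≢-θ a b (r b (punchInᵢ≢i a zero) (punchInᵢ≢i a zero)))
    where b = punchIn a zero

  basic-associated : ∀ s {a b} → Basic R → Associated R s a b → a ≡ b × s ≡ Sign.+
  basic-associated s {a} {b} (4≤m , noCR) r with a ≟ b
  ... | yes refl = refl , self-associated⇒+ s (<⇒≤ (<⇒≤ 4≤m)) r
  ... | no a≢b   = ⊥-elim (noCR a b a≢b (Associated⇒CRAssociated s (<⇒≤ 4≤m) a≢b r))

module _ {m k} (T : Tournament m) {f : Fin k → Fin m} (inj : Injective _≡_ _≡_ f) where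

  θ-induced : ∀ a b → θ (induced T f inj) a b ≡ θ T (f a) (f b)
  θ-induced a b with dec T (f a) (f b)
  ... | inj₁ _ = refl
  ... | inj₂ _ = refl

  covertexOver-refl : ∀ a → CovertexOver T f (f a) a
  covertexOver-refl a c c≢a = c≢a ∘ inj , refl

  covertexOver-associated : ∀ s {w₁ w₂ a b} → CovertexOver T f w₁ a → CovertexOver T f w₂ b →
                            Associated T s w₁ w₂ → Associated (induced T f inj) s a b
  covertexOver-associated s {w₁} {w₂} {a} {b} cov₁ cov₂ r c c≢a c≢b = begin
    θ (induced T f inj) a c  ≡⟨ θ-induced a c ⟩
    θ T (f a) (f c)          ≡⟨ sym (proj₂ (cov₁ c c≢a)) ⟩
    θ T w₁ (f c)             ≡⟨ r (f c) (proj₁ (cov₁ c c≢a)) (proj₁ (cov₂ c c≢b)) ⟩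
    s ⊙ θ T w₂ (f c)         ≡⟨ cong (s ⊙_) (proj₂ (cov₂ c c≢b)) ⟩
    s ⊙ θ T (f b) (f c)      ≡⟨ cong (s ⊙_) (sym (θ-induced b c)) ⟩
    s ⊙ θ (induced T f inj) b c ∎
    where open ≡-Reasoning

  θ-covertex-covertexOver : ∀ {u u' a b} → a ≢ b → u' ≢ u → CovertexOver T f u' b →
                            Associated T Sign.+ u (f a) → θ T u u' ≡ θ T (f a) (f b)
  θ-covertex-covertexOver {u} {u'} {a} {b} a≢b u'≢u cov r = begin
    θ T u u'             ≡⟨ r u' u'≢u (≢-sym fa≢u') ⟩
    θ T (f a) u'         ≡⟨ θ-antisym T fa≢u' ⟩
    - θ T u' (f a)       ≡⟨ cong -_ (proj₂ (cov a a≢b)) ⟩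
    - θ T (f b) (f a)    ≡⟨ sym (θ-antisym T (a≢b ∘ inj)) ⟩
    θ T (f a) (f b)      ∎
    where
    open ≡-Reasoning
    fa≢u' : f a ≢ u'
    fa≢u' = proj₁ (cov a a≢b)

withU-covertexOver : ∀ {n} (T : Tournament (suc (suc n))) {u i}
                     (inj : Injective _≡_ _≡_ (withU u)) →
                     Covertices (induced T (withU u) inj) zero (suc i) → CovertexOver T v u i
withU-covertexOver T {u} {i} inj (_ , _ , cov) c c≢i = vc≢u , (begin
  θ T u (v c)                                  ≡⟨ sym (θ-induced T inj zero (suc c)) ⟩
  θ (induced T (withU u) inj) zero (suc c)     ≡⟨ cov (suc c) (0≢1+n ∘ sym) (c≢i ∘ suc-injective) ⟩
  θ (induced T (withU u) inj) (suc i) (suc c)  ≡⟨ θ-induced T inj (suc i) (suc c) ⟩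
  θ T (v i) (v c)                              ∎)
  where
  open ≡-Reasoning
  vc≢u : v c ≢ u
  vc≢u e = 0≢1+n (sym (inj e))

module CovertexPair {n} (T : Tournament (suc (suc n))) {i j : Fin n} (i≢j : i ≢ j)
  (cov₁ : CovertexOver T v u₁ i) (cov₂ : CovertexOver T v u₂ j)
  (θu₁u₂≢θvivj : θ T u₁ u₂ ≢ θ T (v i) (v j)) where

  ρ : Fin (suc (suc n)) → Fin n
  ρ zero          = i
  ρ (suc zero)    = j
  ρ (suc (suc a)) = a

  covertexOver-ρ : ∀ w → CovertexOver T v w (ρ w)
  covertexOver-ρ zero          = cov₁
  covertexOver-ρ (suc zero)    = cov₂
  covertexOver-ρ (suc (suc a)) = covertexOver-refl T v-inj a

  ¬u₁~vi : ¬ Associated T Sign.+ u₁ (v i)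
  ¬u₁~vi r = θu₁u₂≢θvivj (θ-covertex-covertexOver T v-inj i≢j (λ ()) cov₂ r)

  ¬u₂~vj : ¬ Associated T Sign.+ u₂ (v j)
  ¬u₂~vj r = θu₁u₂≢θvivj (θ-flip T (λ ()) (i≢j ∘ sym ∘ v-inj)
    (θ-covertex-covertexOver T v-inj (i≢j ∘ sym) (λ ()) cov₁ r))

  ¬covertices : ∀ w₁ w₂ → w₁ ≢ w₂ → ρ w₁ ≡ ρ w₂ → ¬ Associated T Sign.+ w₁ w₂
  ¬covertices zero          zero           w₁≢w₂ _    _ = w₁≢w₂ refl
  ¬covertices zero          (suc zero)     _     i≡j  _ = i≢j i≡j
  ¬covertices zero          (suc (suc .i)) _     refl r = ¬u₁~vi r
  ¬covertices (suc zero)    zero           _     j≡i  _ = i≢j (sym j≡i)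
  ¬covertices (suc zero)    (suc zero)     w₁≢w₂ _    _ = w₁≢w₂ refl
  ¬covertices (suc zero)    (suc (suc .j)) _     refl r = ¬u₂~vj r
  ¬covertices (suc (suc _)) zero           _     refl r = ¬u₁~vi (Associated-sym T Sign.+ r)
  ¬covertices (suc (suc _)) (suc zero)     _     refl r = ¬u₂~vj (Associated-sym T Sign.+ r)
  ¬covertices (suc (suc a)) (suc (suc b))  w₁≢w₂ a≡b  _ = w₁≢w₂ (cong v a≡b)

  ¬CRAssociated : Basic (induced T v v-inj) → ∀ w₁ w₂ → w₁ ≢ w₂ → ¬ CRAssociated T w₁ w₂
  ¬CRAssociated basic w₁ w₂ w₁≢w₂ cr with CRAssociated⇒Associated T cr
  ... | s , r with basic-associated (induced T v v-inj) s basic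
                     (covertexOver-associated T v-inj s (covertexOver-ρ w₁) (covertexOver-ρ w₂) r)
  ... | ρw₁≡ρw₂ , refl = ¬covertices w₁ w₂ w₁≢w₂ ρw₁≡ρw₂ r

proposition3p12 : (n : ℕ) (T : Tournament (suc (suc n))) →
    Basic (induced T v v-inj) →
    (i j : Fin n) → i ≢ j →
    Covertices (induced T (withU u₁) withU₁-inj) zero (suc i) →
    Covertices (induced T (withU u₂) withU₂-inj) zero (suc j) →
    θ T u₁ u₂ * θ T (v i) (v j) ≡ - (+ 1) →
    Basic T
proposition3p12 n T basic i j i≢j cov₁ cov₂ sign =
  m≤n⇒m≤1+n (m≤n⇒m≤1+n (proj₁ basic)) ,
  CovertexPair.¬CRAssociated T i≢j
    (withU-covertexOver T withU₁-inj cov₁)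
    (withU-covertexOver T withU₂-inj cov₂)
    (θ*θ≡-1⇒θ≢θ T u₁ u₂ (v i) (v j) sign)
    basic
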